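{- For positive integers $n,k,t$ with $k,t\le n$, \[\left[{n\atop k/t}\right]=(t+k-1)_{k-1}\left[{n\atop t+k-1}\right],\] where $(x)_m=x(x-1)\cdots(x-m+1)$ is the falling factorial.
   Context: $\left[{n\atop m}\right]$ is the signless Stirling number of the first kind (number of permutations of $[n]$ with exactly $m$ cycles). For integers $n\ge0$, $k\ge1$, $t\ge0$, a mixed coloured permutation of $[n]$ is a permutation of $[n]$ together with a colouring of its cycles with colours from $\{1,\ldots,k\}$ such that exactly $t$ cycles receive colour $1$ (the special colour) and each of the colours $2,\ldots,k$ is used on exactly one cycle; $\left[{n\atop k/t}\right]$ denotes their number. -}

module Defs where

open import Data.Nat using (ℕ; zero; suc; _+_; _*_; _∸_; _≤ᵇ_; _≡ᵇ_)
open import Data.Fin using (Fin; toℕ; _≟_)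
open import Data.Bool using (Bool; true; false; _∧_; if_then_else_)
open import Data.List using (List; []; _∷_; concatMap; map; allFin; filterᵇ; length; upTo; cartesianProduct)
open import Data.Vec using (Vec; lookup) renaming ([] to []v; _∷_ to _∷v_)
open import Data.Product using (_×_; _,_)
open import Relation.Nullary.Decidable using (⌊_⌋)

all : ∀ {A : Set} → (A → Bool) → List A → Bool
all p []       = true
all p (x ∷ xs) = p x ∧ all p xs

-- All functions Fin n → Fin m, represented as vectors of length n (lookup = application).
allVecs : (n m : ℕ) → List (Vec (Fin m) n)
allVecs zero    m = []v ∷ []
allVecs (suc n) m = concatMap (λ a → map (a ∷v_) (allVecs n m)) (allFin m)

finEq : ∀ {m} → Fin m → Fin m → Bool
finEq a b = ⌊ a ≟ b ⌋

-- σ is a permutation of [n] (injective self-map of a finite set).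
isPerm : ∀ {n} → Vec (Fin n) n → Bool
isPerm {n} σ = all (λ i → all (λ j → if finEq (lookup σ i) (lookup σ j) then finEq i j else true) (allFin n)) (allFin n)

perms : (n : ℕ) → List (Vec (Fin n) n)
perms n = filterᵇ isPerm (allVecs n n)

iter : ∀ {n} → Vec (Fin n) n → ℕ → Fin n → Fin n
iter σ zero    x = x
iter σ (suc m) x = lookup σ (iter σ m x)

-- x is the least element of its cycle under σ (each cycle has exactly one such element,
-- so cycles are counted by counting these representatives).
isCycleMin : ∀ {n} → Vec (Fin n) n → Fin n → Bool
isCycleMin {n} σ x = all (λ m → toℕ x ≤ᵇ toℕ (iter σ m x)) (upTo n)

numCycles : ∀ {n} → Vec (Fin n) n → ℕ
numCycles {n} σ = length (filterᵇ (isCycleMin σ) (allFin n))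

stirling1 : ℕ → ℕ → ℕ
stirling1 n m = length (filterᵇ (λ σ → numCycles σ ≡ᵇ m) (perms n))

-- A colouring of the elements with colours Fin k that is constant on every cycle of σ
-- is exactly a colouring of the cycles of σ.
isCycleColouring : ∀ {n k} → Vec (Fin n) n → Vec (Fin k) n → Bool
isCycleColouring {n} σ c = all (λ x → finEq (lookup c (lookup σ x)) (lookup c x)) (allFin n)

cyclesOfColour : ∀ {n k} → Vec (Fin n) n → Vec (Fin k) n → Fin k → ℕ
cyclesOfColour {n} σ c j = length (filterᵇ (λ x → isCycleMin σ x ∧ finEq (lookup c x) j) (allFin n))

-- Colour 1 of the paper is Fin.zero here; colours 2..k are Fin.suc _ .
-- Mixed condition: exactly t cycles of the special colour, every other colour on exactly one cycle.
isMixed : ∀ {n k} → ℕ → Vec (Fin n) n → Vec (Fin k) n → Bool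
isMixed {n} {zero}  t σ c = false   -- no colours at all (k ≥ 1 is assumed anyway)
isMixed {n} {suc k} t σ c =
  isCycleColouring σ c
  ∧ (cyclesOfColour σ c Fin.zero ≡ᵇ t)
  ∧ all (λ j → cyclesOfColour σ c (Fin.suc j) ≡ᵇ 1) (allFin k)
  where import Data.Fin as Fin

mixedStirling : ℕ → ℕ → ℕ → ℕ
mixedStirling n k t =
  length (filterᵇ (λ p → isMixedP p) (cartesianProduct (perms n) (allVecs n k)))
  where
    isMixedP : Vec (Fin n) n × Vec (Fin k) n → Bool
    isMixedP (σ , c) = isMixed t σ c

fallingFact : ℕ → ℕ → ℕ
fallingFact x zero    = 1
fallingFact x (suc m) = fallingFact x m * (x ∸ m)

module Submission where

-- Write k = 1+k′ and fix a permutation σ of [n] with m cycles.  A mixed colouring of σ gives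
-- colour 0 to exactly t cycles and each colour 1, …, k′ to exactly one cycle, so there are
-- m! / (t! · 1!^k′) of them if m = t+k′ (a multinomial coefficient) and none otherwise.  As
-- (t+k′)_{k′} · t! = (t+k′)!, that is [m = t+k′] · (t+k′)_{k′}, and summing over σ gives the theorem.

open import Data.Bool using (Bool; true; false; _∧_; _∨_; if_then_else_)
open import Data.Bool.Properties using (T-≡)
open import Data.Empty using (⊥-elim)
open import Data.Fin using (Fin; toℕ; _≟_) renaming (zero to fz; suc to fs)
open import Data.Fin.Properties using (toℕ-injective; pigeonhole; toℕ<n)
open import Data.List using (List; []; _∷_; _++_; map; concatMap; filterᵇ; length; tabulate; allFin; upTo; applyUpTo; cartesianProduct)
open import Data.List.Relation.Unary.All.Properties using (applyUpTo⁺₂; applyUpTo⁻)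
open import Data.Nat using (ℕ; zero; suc; _+_; _*_; _∸_; _≤_; _<_; _≡ᵇ_; _!; s≤s)
open import Data.Nat.DivMod using (_%_; _/_; m%n<n; m≡m%n+[m/n]*n)
open import Data.Nat.Properties hiding (_≟_)
open import Algebra.Properties.CommutativeSemigroup +-commutativeSemigroup using (interchange)
open import Algebra.Properties.CommutativeSemigroup *-commutativeSemigroup using (x∙yz≈y∙xz)
open import Data.List.Extrema ≤-totalOrder using (argmin; argmin-all; f[argmin]≤f[xs])
open import Data.Product using (_×_; _,_; proj₁; proj₂; Σ)
open import Data.Vec using (Vec; lookup) renaming ([] to []ᵥ; _∷_ to _∷ᵥ_; tabulate to tabulateᵥ)
open import Data.Vec.Properties using (lookup∘tabulate; tabulate∘lookup; tabulate-cong; ≡-dec)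
open import Function using (_∘_; id; Equivalence)
open import Relation.Binary.Definitions using (DecidableEquality)
open import Relation.Binary.PropositionalEquality
open import Relation.Nullary using (Dec; yes; no)
open import Relation.Nullary.Decidable using (⌊_⌋)
open import Defs

𝟙 : Bool → ℕ
𝟙 true  = 1
𝟙 false = 0

𝟙-∧ : ∀ a b → 𝟙 (a ∧ b) ≡ 𝟙 a * 𝟙 b
𝟙-∧ true  b = sym (+-identityʳ (𝟙 b))
𝟙-∧ false b = refl

∧-split : ∀ {a b} → a ∧ b ≡ true → a ≡ true × b ≡ true
∧-split {true} {true} _ = refl , refl

∧-intro : ∀ {a b} → a ≡ true → b ≡ true → a ∧ b ≡ true
∧-intro refl refl = refl

bool-ext : ∀ {a b} → (a ≡ true → b ≡ true) → (b ≡ true → a ≡ true) → a ≡ b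
bool-ext {true}  {true}  _ _ = refl
bool-ext {true}  {false} f _ = sym (f refl)
bool-ext {false} {true}  _ g = g refl
bool-ext {false} {false} _ _ = refl

isYes-sound : ∀ {P : Set} (d : Dec P) → ⌊ d ⌋ ≡ true → P
isYes-sound (yes p) _ = p

isYes-complete : ∀ {P : Set} (d : Dec P) → P → ⌊ d ⌋ ≡ true
isYes-complete (yes _) _ = refl
isYes-complete (no ¬p) p = ⊥-elim (¬p p)

finEq-sound : ∀ {m} {a b : Fin m} → finEq a b ≡ true → a ≡ b
finEq-sound {a = a} {b} = isYes-sound (a ≟ b)

finEq-refl : ∀ {m} (a : Fin m) → finEq a a ≡ true
finEq-refl a = isYes-complete (a ≟ a) refl

finEq-suc : ∀ {m} (a b : Fin m) → finEq (fs a) (fs b) ≡ finEq a b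
finEq-suc a b with a ≟ b
... | yes _ = refl
... | no  _ = refl

sumL : ∀ {A : Set} → (A → ℕ) → List A → ℕ
sumL f []       = 0
sumL f (x ∷ xs) = f x + sumL f xs

length-filterᵇ : ∀ {A : Set} (p : A → Bool) (xs : List A) → length (filterᵇ p xs) ≡ sumL (𝟙 ∘ p) xs
length-filterᵇ p []       = refl
length-filterᵇ p (x ∷ xs) with p x
... | true  = cong suc (length-filterᵇ p xs)
... | false = length-filterᵇ p xs

sumL-cong : ∀ {A : Set} {f g : A → ℕ} (xs : List A) → (∀ x → f x ≡ g x) → sumL f xs ≡ sumL g xs
sumL-cong []       e = refl
sumL-cong (x ∷ xs) e = cong₂ _+_ (e x) (sumL-cong xs e)

sumL-zero : ∀ {A : Set} (xs : List A) → sumL (λ _ → 0) xs ≡ 0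
sumL-zero []       = refl
sumL-zero (x ∷ xs) = sumL-zero xs

sumL-++ : ∀ {A : Set} (f : A → ℕ) (xs ys : List A) → sumL f (xs ++ ys) ≡ sumL f xs + sumL f ys
sumL-++ f []       ys = refl
sumL-++ f (x ∷ xs) ys = trans (cong (f x +_) (sumL-++ f xs ys)) (sym (+-assoc (f x) _ _))

sumL-map : ∀ {A B : Set} (f : B → ℕ) (g : A → B) (xs : List A) → sumL f (map g xs) ≡ sumL (f ∘ g) xs
sumL-map f g []       = refl
sumL-map f g (x ∷ xs) = cong (f (g x) +_) (sumL-map f g xs)

sumL-concatMap : ∀ {A B : Set} (f : B → ℕ) (g : A → List B) (xs : List A) →
  sumL f (concatMap g xs) ≡ sumL (λ a → sumL f (g a)) xs
sumL-concatMap f g []       = refl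
sumL-concatMap f g (x ∷ xs) =
  trans (sumL-++ f (g x) (concatMap g xs)) (cong (sumL f (g x) +_) (sumL-concatMap f g xs))

sumL-cartesianProduct : ∀ {A B : Set} (f : A × B → ℕ) (xs : List A) (ys : List B) →
  sumL f (cartesianProduct xs ys) ≡ sumL (λ x → sumL (λ y → f (x , y)) ys) xs
sumL-cartesianProduct f []       ys = refl
sumL-cartesianProduct f (x ∷ xs) ys =
  trans (sumL-++ f (map (x ,_) ys) _) (cong₂ _+_ (sumL-map f (x ,_) ys) (sumL-cartesianProduct f xs ys))

sumL-*ˡ : ∀ {A : Set} (a : ℕ) (f : A → ℕ) (xs : List A) → sumL (λ x → a * f x) xs ≡ a * sumL f xs
sumL-*ˡ a f []       = sym (*-zeroʳ a)
sumL-*ˡ a f (x ∷ xs) = trans (cong (a * f x +_) (sumL-*ˡ a f xs)) (sym (*-distribˡ-+ a (f x) _))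

sumL-+ : ∀ {A : Set} (f g : A → ℕ) (xs : List A) → sumL (λ x → f x + g x) xs ≡ sumL f xs + sumL g xs
sumL-+ f g []       = refl
sumL-+ f g (x ∷ xs) = trans (cong (f x + g x +_) (sumL-+ f g xs)) (interchange (f x) (g x) _ _)

sumL-swap : ∀ {A B : Set} (f : A → B → ℕ) (xs : List A) (ys : List B) →
  sumL (λ x → sumL (f x) ys) xs ≡ sumL (λ y → sumL (λ x → f x y) xs) ys
sumL-swap f []       ys = sym (sumL-zero ys)
sumL-swap f (x ∷ xs) ys =
  trans (cong (sumL (f x) ys +_) (sumL-swap f xs ys)) (sym (sumL-+ (f x) (λ y → sumL (λ x′ → f x′ y) xs) ys))

sumL-filter-cong : ∀ {A : Set} (p : A → Bool) {f g : A → ℕ} (xs : List A) →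
  (∀ x → p x ≡ true → f x ≡ g x) → sumL f (filterᵇ p xs) ≡ sumL g (filterᵇ p xs)
sumL-filter-cong p []       e = refl
sumL-filter-cong p (x ∷ xs) e with p x in px
... | true  = cong₂ _+_ (e x px) (sumL-filter-cong p xs e)
... | false = sumL-filter-cong p xs e

sumFin : (k : ℕ) → (Fin k → ℕ) → ℕ
sumFin zero    f = 0
sumFin (suc k) f = f fz + sumFin k (f ∘ fs)

prodFin : (k : ℕ) → (Fin k → ℕ) → ℕ
prodFin zero    f = 1
prodFin (suc k) f = f fz * prodFin k (f ∘ fs)

countFin : (k : ℕ) → (Fin k → Bool) → ℕ
countFin k p = sumFin k (𝟙 ∘ p)

everyFin : (k : ℕ) → (Fin k → Bool) → Bool
everyFin zero    p = true
everyFin (suc k) p = p fz ∧ everyFin k (p ∘ fs)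

sumFin-cong : ∀ k {f g : Fin k → ℕ} → (∀ x → f x ≡ g x) → sumFin k f ≡ sumFin k g
sumFin-cong zero    e = refl
sumFin-cong (suc k) e = cong₂ _+_ (e fz) (sumFin-cong k (e ∘ fs))

prodFin-cong : ∀ k {f g : Fin k → ℕ} → (∀ x → f x ≡ g x) → prodFin k f ≡ prodFin k g
prodFin-cong zero    e = refl
prodFin-cong (suc k) e = cong₂ _*_ (e fz) (prodFin-cong k (e ∘ fs))

countFin-cong : ∀ k {p q : Fin k → Bool} → (∀ x → p x ≡ q x) → countFin k p ≡ countFin k q
countFin-cong k e = sumFin-cong k (cong 𝟙 ∘ e)

everyFin-cong : ∀ k {p q : Fin k → Bool} → (∀ x → p x ≡ q x) → everyFin k p ≡ everyFin k q
everyFin-cong zero    e = refl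
everyFin-cong (suc k) e = cong₂ _∧_ (e fz) (everyFin-cong k (e ∘ fs))

sumFin-zero : ∀ k → sumFin k (λ _ → 0) ≡ 0
sumFin-zero zero    = refl
sumFin-zero (suc k) = sumFin-zero k

sumFin-one : ∀ k → sumFin k (λ _ → 1) ≡ k
sumFin-one zero    = refl
sumFin-one (suc k) = cong suc (sumFin-one k)

prodFin-one : ∀ k → prodFin k (λ _ → 1) ≡ 1
prodFin-one zero    = refl
prodFin-one (suc k) = trans (+-identityʳ _) (prodFin-one k)

sumFin-*ʳ : ∀ k (f : Fin k → ℕ) c → sumFin k (λ a → f a * c) ≡ sumFin k f * c
sumFin-*ʳ zero    f c = refl
sumFin-*ʳ (suc k) f c = trans (cong (f fz * c +_) (sumFin-*ʳ k (f ∘ fs) c)) (sym (*-distribʳ-+ c (f fz) _))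

sumFin-point : ∀ k (a : Fin k) → sumFin k (λ b → 𝟙 (finEq b a)) ≡ 1
sumFin-point (suc k) fz     = cong suc (sumFin-zero k)
sumFin-point (suc k) (fs a) = trans (sumFin-cong k (λ b → cong 𝟙 (finEq-suc b a))) (sumFin-point k a)

sumFin-bump : ∀ k (f : Fin k → ℕ) a → sumFin k (λ j → f j + 𝟙 (finEq a j)) ≡ suc (sumFin k f)
sumFin-bump (suc k) f fz     = cong₂ _+_ (+-comm (f fz) 1) (sumFin-cong k (λ j → +-identityʳ (f (fs j))))
sumFin-bump (suc k) f (fs a) =
  trans (cong₂ _+_ (+-identityʳ (f fz))
          (trans (sumFin-cong k (λ j → cong (λ b → f (fs j) + 𝟙 b) (finEq-suc a j))) (sumFin-bump k (f ∘ fs) a)))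
        (+-suc (f fz) _)

prodFin-bump : ∀ k (f : Fin k → ℕ) a → prodFin k (λ j → (f j + 𝟙 (finEq a j)) !) ≡ suc (f a) * prodFin k (λ j → f j !)
prodFin-bump (suc k) f fz =
  trans (cong₂ _*_ (cong _! (+-comm (f fz) 1)) (prodFin-cong k (λ j → cong _! (+-identityʳ (f (fs j))))))
        (*-assoc (suc (f fz)) (f fz !) _)
prodFin-bump (suc k) f (fs a) =
  trans (cong₂ _*_ (cong _! (+-identityʳ (f fz)))
          (trans (prodFin-cong k (λ j → cong (λ b → (f (fs j) + 𝟙 b) !) (finEq-suc a j))) (prodFin-bump k (f ∘ fs) a)))
        (x∙yz≈y∙xz (f fz !) (suc (f (fs a))) _)

everyFin-sound : ∀ k {p : Fin k → Bool} → everyFin k p ≡ true → ∀ x → p x ≡ true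
everyFin-sound (suc k) e fz     = proj₁ (∧-split e)
everyFin-sound (suc k) e (fs x) = everyFin-sound k (proj₂ (∧-split e)) x

everyFin-complete : ∀ k {p : Fin k → Bool} → (∀ x → p x ≡ true) → everyFin k p ≡ true
everyFin-complete zero    h = refl
everyFin-complete (suc k) h = ∧-intro (h fz) (everyFin-complete k (h ∘ fs))

sumL-tabulate : ∀ {A : Set} k (f : A → ℕ) (g : Fin k → A) → sumL f (tabulate g) ≡ sumFin k (f ∘ g)
sumL-tabulate zero    f g = refl
sumL-tabulate (suc k) f g = cong (f (g fz) +_) (sumL-tabulate k f (g ∘ fs))

length-filter-allFin : ∀ k (p : Fin k → Bool) → length (filterᵇ p (allFin k)) ≡ countFin k p
length-filter-allFin k p = trans (length-filterᵇ p (allFin k)) (sumL-tabulate k (𝟙 ∘ p) id)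

all-tabulate : ∀ {A : Set} k (p : A → Bool) (g : Fin k → A) → all p (tabulate g) ≡ everyFin k (p ∘ g)
all-tabulate zero    p g = refl
all-tabulate (suc k) p g = cong (p (g fz) ∧_) (all-tabulate k p (g ∘ fs))

all-allFin : ∀ k (p : Fin k → Bool) → all p (allFin k) ≡ everyFin k p
all-allFin k p = all-tabulate k p id

all-allFin-sound : ∀ k {p : Fin k → Bool} → all p (allFin k) ≡ true → ∀ x → p x ≡ true
all-allFin-sound k {p} e = everyFin-sound k (trans (sym (all-allFin k p)) e)

all-complete : ∀ {A : Set} {p : A → Bool} (xs : List A) → (∀ x → p x ≡ true) → all p xs ≡ true
all-complete []       h = refl
all-complete (x ∷ xs) h = ∧-intro (h x) (all-complete xs h)

all-applyUpTo-sound : ∀ n (f : ℕ → ℕ) {p : ℕ → Bool} → all p (applyUpTo f n) ≡ true →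
  ∀ b → b < n → p (f b) ≡ true
all-applyUpTo-sound (suc n) f e zero    _         = proj₁ (∧-split e)
all-applyUpTo-sound (suc n) f e (suc b) (s≤s b<n) = all-applyUpTo-sound n (f ∘ suc) (proj₂ (∧-split e)) b b<n

Enumerates : ∀ {A : Set} → DecidableEquality A → List A → Set
Enumerates {A} _≟ᴬ_ xs = ∀ (a : A) → sumL (λ x → 𝟙 ⌊ x ≟ᴬ a ⌋) xs ≡ 1

module DoubleCounting {A B : Set} (_≟ᴬ_ : DecidableEquality A) (_≟ᴮ_ : DecidableEquality B)
                      (xs : List A) (ys : List B) (xs-enum : Enumerates _≟ᴬ_ xs) (ys-enum : Enumerates _≟ᴮ_ ys)
                      (P : A → Bool) (Q : B → Bool) (g : A → B) (h : B → A)
                      (g-maps : ∀ x → P x ≡ true → Q (g x) ≡ true × h (g x) ≡ x)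
                      (h-maps : ∀ y → Q y ≡ true → P (h y) ≡ true × g (h y) ≡ y) where

  graph-symmetric : ∀ x y → (P x ∧ ⌊ y ≟ᴮ g x ⌋) ≡ (Q y ∧ ⌊ x ≟ᴬ h y ⌋)
  graph-symmetric x y = bool-ext to from
    where
    to : P x ∧ ⌊ y ≟ᴮ g x ⌋ ≡ true → Q y ∧ ⌊ x ≟ᴬ h y ⌋ ≡ true
    to e with ∧-split {P x} e
    ... | px , y≡gx with isYes-sound (y ≟ᴮ g x) y≡gx
    ... | refl = ∧-intro (proj₁ (g-maps x px)) (isYes-complete (x ≟ᴬ h (g x)) (sym (proj₂ (g-maps x px))))
    from : Q y ∧ ⌊ x ≟ᴬ h y ⌋ ≡ true → P x ∧ ⌊ y ≟ᴮ g x ⌋ ≡ true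
    from e with ∧-split {Q y} e
    ... | qy , x≡hy with isYes-sound (x ≟ᴬ h y) x≡hy
    ... | refl = ∧-intro (proj₁ (h-maps y qy)) (isYes-complete (y ≟ᴮ g (h y)) (sym (proj₂ (h-maps y qy))))

  select : ∀ {C : Set} (b : Bool) (e : C → Bool) (zs : List C) → sumL (𝟙 ∘ e) zs ≡ 1 →
    sumL (λ z → 𝟙 (b ∧ e z)) zs ≡ 𝟙 b
  select b e zs once = begin
    sumL (λ z → 𝟙 (b ∧ e z)) zs   ≡⟨ sumL-cong zs (λ z → 𝟙-∧ b (e z)) ⟩
    sumL (λ z → 𝟙 b * 𝟙 (e z)) zs ≡⟨ sumL-*ˡ (𝟙 b) (𝟙 ∘ e) zs ⟩
    𝟙 b * sumL (𝟙 ∘ e) zs         ≡⟨ cong (𝟙 b *_) once ⟩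
    𝟙 b * 1                        ≡⟨ *-identityʳ (𝟙 b) ⟩
    𝟙 b                            ∎
    where open ≡-Reasoning

  -- Weight each x with P x by the number of y equal to g x (namely one), and swap the sums.
  count-bijection : sumL (𝟙 ∘ P) xs ≡ sumL (𝟙 ∘ Q) ys
  count-bijection = begin
    sumL (𝟙 ∘ P) xs
      ≡⟨ sumL-cong xs (λ x → sym (select (P x) _ ys (ys-enum (g x)))) ⟩
    sumL (λ x → sumL (λ y → 𝟙 (P x ∧ ⌊ y ≟ᴮ g x ⌋)) ys) xs
      ≡⟨ sumL-swap _ xs ys ⟩
    sumL (λ y → sumL (λ x → 𝟙 (P x ∧ ⌊ y ≟ᴮ g x ⌋)) xs) ys
      ≡⟨ sumL-cong ys (λ y → sumL-cong xs (λ x → cong 𝟙 (graph-symmetric x y))) ⟩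
    sumL (λ y → sumL (λ x → 𝟙 (Q y ∧ ⌊ x ≟ᴬ h y ⌋)) xs) ys
      ≡⟨ sumL-cong ys (λ y → select (Q y) _ xs (xs-enum (h y))) ⟩
    sumL (𝟙 ∘ Q) ys ∎
    where open ≡-Reasoning

vec-ext : ∀ {A : Set} {n} {u v : Vec A n} → (∀ x → lookup u x ≡ lookup v x) → u ≡ v
vec-ext {u = u} {v} h = trans (sym (tabulate∘lookup u)) (trans (tabulate-cong h) (tabulate∘lookup v))

_≟ᵥ_ : ∀ {n k} → DecidableEquality (Vec (Fin k) n)
_≟ᵥ_ = ≡-dec _≟_

allVecs-split : ∀ n k (f : Vec (Fin k) (suc n) → ℕ) →
  sumL f (allVecs (suc n) k) ≡ sumFin k (λ a → sumL (λ d → f (a ∷ᵥ d)) (allVecs n k))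
allVecs-split n k f =
  trans (sumL-concatMap f (λ a → map (a ∷ᵥ_) (allVecs n k)) (allFin k))
  (trans (sumL-cong (allFin k) (λ a → sumL-map f (a ∷ᵥ_) (allVecs n k)))
         (sumL-tabulate k (λ a → sumL (λ d → f (a ∷ᵥ d)) (allVecs n k)) id))

≟ᵥ-cons : ∀ {n k} (a b : Fin k) (u v : Vec (Fin k) n) → ⌊ (a ∷ᵥ u) ≟ᵥ (b ∷ᵥ v) ⌋ ≡ finEq a b ∧ ⌊ u ≟ᵥ v ⌋
≟ᵥ-cons a b u v with a ≟ b | u ≟ᵥ v
... | yes _ | yes _ = refl
... | yes _ | no  _ = refl
... | no  _ | _     = refl

allVecs-enumerates : ∀ n k → Enumerates _≟ᵥ_ (allVecs n k)
allVecs-enumerates zero    k []ᵥ       = refl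
allVecs-enumerates (suc n) k (a ∷ᵥ v) = begin
  sumL (λ u → 𝟙 ⌊ u ≟ᵥ (a ∷ᵥ v) ⌋) (allVecs (suc n) k)
    ≡⟨ allVecs-split n k _ ⟩
  sumFin k (λ b → sumL (λ u → 𝟙 ⌊ (b ∷ᵥ u) ≟ᵥ (a ∷ᵥ v) ⌋) (allVecs n k))
    ≡⟨ sumFin-cong k (λ b → sumL-cong (allVecs n k) (λ u → trans (cong 𝟙 (≟ᵥ-cons b a u v)) (𝟙-∧ (finEq b a) _))) ⟩
  sumFin k (λ b → sumL (λ u → 𝟙 (finEq b a) * 𝟙 ⌊ u ≟ᵥ v ⌋) (allVecs n k))
    ≡⟨ sumFin-cong k (λ b → trans (sumL-*ˡ (𝟙 (finEq b a)) _ (allVecs n k))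
                                  (trans (cong (𝟙 (finEq b a) *_) (allVecs-enumerates n k v)) (*-identityʳ _))) ⟩
  sumFin k (λ b → 𝟙 (finEq b a))
    ≡⟨ sumFin-point k a ⟩
  1 ∎
  where open ≡-Reasoning

-- With nothing marked, only the zero profile is realised (by the constant colouring 0):
-- the profile condition holds iff all R j vanish, and then ∏ (R j)! = 1.
empty-profile : ∀ K (R : Fin K → ℕ) →
  𝟙 (everyFin K (λ j → 0 ≡ᵇ R j)) * prodFin K (λ j → R j !) ≡ 𝟙 (0 ≡ᵇ sumFin K R)
empty-profile zero    R = refl
empty-profile (suc K) R with R fz
... | zero  = trans (cong (𝟙 (everyFin K (λ j → 0 ≡ᵇ R (fs j))) *_) (+-identityʳ _)) (empty-profile K (R ∘ fs))
... | suc _ = refl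

-- Closing the induction step of the multinomial count:
--   Σ R · [m = ΣR − 1] · m! = [m + 1 = ΣR] · (m + 1)! .
weighted-indicator : ∀ s m f → s * (𝟙 (m ≡ᵇ s ∸ 1) * f) ≡ 𝟙 (suc m ≡ᵇ s) * (suc m * f)
weighted-indicator zero    m f = refl
weighted-indicator (suc s) m f with m ≡ᵇ s in m≟s
... | true  rewrite ≡ᵇ⇒≡ m s (Equivalence.from T-≡ m≟s) =
  trans (cong (suc s *_) (*-identityˡ f)) (sym (*-identityˡ _))
... | false = *-zeroʳ (suc s)

-- The colourings supported on S with a given
-- profile R are counted by the multinomial coefficient (|S| choose R), i.e.
--   colourings S R * ∏ⱼ (R j)! = [ |S| = Σⱼ R j ] * |S|! .

module Multinomial (k : ℕ) where

  Colour : Set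
  Colour = Fin (suc k)

  marked : ∀ {n} → Vec Bool n → ℕ
  marked {n} S = countFin n (lookup S)

  supportedOn : ∀ {n} → Vec Bool n → Vec Colour n → Bool
  supportedOn {n} S d = everyFin n (λ x → lookup S x ∨ finEq (lookup d x) fz)

  classSize : ∀ {n} → Vec Bool n → Vec Colour n → Colour → ℕ
  classSize {n} S d j = countFin n (λ x → lookup S x ∧ finEq (lookup d x) j)

  hasProfile : ∀ {n} → Vec Bool n → (Colour → ℕ) → Vec Colour n → Bool
  hasProfile S R d = supportedOn S d ∧ everyFin (suc k) (λ j → classSize S d j ≡ᵇ R j)

  colourings : ∀ {n} → Vec Bool n → (Colour → ℕ) → ℕ
  colourings {n} S R = sumL (𝟙 ∘ hasProfile S R) (allVecs n (suc k))

  total : (Colour → ℕ) → ℕ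
  total R = sumFin (suc k) R

  factorials : (Colour → ℕ) → ℕ
  factorials R = prodFin (suc k) (λ j → R j !)

  removeColour : (Colour → ℕ) → Colour → Colour → ℕ
  removeColour R a j = R j ∸ 𝟙 (finEq a j)

  module _ (R : Colour → ℕ) (a : Colour) {r : ℕ} (Ra≡1+r : R a ≡ suc r) where

    removeColour-restore : ∀ j → removeColour R a j + 𝟙 (finEq a j) ≡ R j
    removeColour-restore j with finEq a j in a≟j
    ... | true  rewrite sym (finEq-sound a≟j) | Ra≡1+r = +-comm r 1
    ... | false = +-identityʳ (R j)

    total-removeColour : total R ≡ suc (total (removeColour R a))
    total-removeColour =
      trans (sumFin-cong (suc k) (sym ∘ removeColour-restore)) (sumFin-bump (suc k) (removeColour R a) a)

    factorials-removeColour : factorials R ≡ suc r * factorials (removeColour R a)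
    factorials-removeColour =
      trans (prodFin-cong (suc k) (λ j → cong _! (sym (removeColour-restore j))))
      (trans (prodFin-bump (suc k) (removeColour R a) a)
             (cong (λ m → suc m * factorials (removeColour R a)) removed-once))
      where
      removed-once : removeColour R a a ≡ r
      removed-once rewrite finEq-refl a | Ra≡1+r = refl

    profile-marked-head : ∀ {n} (S : Vec Bool n) (d : Vec Colour n) →
      hasProfile (true ∷ᵥ S) R (a ∷ᵥ d) ≡ hasProfile S (removeColour R a) d
    profile-marked-head S d = cong (supportedOn S d ∧_) (everyFin-cong (suc k) (λ j → shift (classSize S d j) j))
      where
      shift : ∀ c j → ((𝟙 (finEq a j) + c) ≡ᵇ R j) ≡ (c ≡ᵇ removeColour R a j)
      shift c j with finEq a j in a≟j
      ... | true  rewrite sym (finEq-sound a≟j) | Ra≡1+r = refl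
      ... | false = refl

  profile-marked-head-absent : ∀ {n} (S : Vec Bool n) (R : Colour → ℕ) a → R a ≡ 0 → ∀ d →
    hasProfile (true ∷ᵥ S) R (a ∷ᵥ d) ≡ false
  profile-marked-head-absent S R a Ra≡0 d =
    bool-ext (λ h → impossible (everyFin-sound (suc k) {fits} (proj₂ (∧-split {supportedOn S d} h)) a)) λ ()
    where
    fits : Colour → Bool
    fits j = (𝟙 (finEq a j) + classSize S d j) ≡ᵇ R j

    impossible : ((𝟙 (finEq a a) + classSize S d a) ≡ᵇ R a) ≡ true → false ≡ true
    impossible h rewrite finEq-refl a | Ra≡0 = h

  -- An unmarked first position must get colour 0 and does not change the profile.
  colourings-unmarked-head : ∀ {n} (S : Vec Bool n) R → colourings (false ∷ᵥ S) R ≡ colourings S R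
  colourings-unmarked-head {n} S R =
    trans (allVecs-split n (suc k) (𝟙 ∘ hasProfile (false ∷ᵥ S) R))
    (trans (cong (colourings S R +_) (trans (sumFin-cong k (λ _ → sumL-zero (allVecs n (suc k)))) (sumFin-zero k)))
           (+-identityʳ _))

  marked-head-colour : ∀ {n} (S : Vec Bool n) R →
    (∀ R′ → colourings S R′ * factorials R′ ≡ 𝟙 (marked S ≡ᵇ total R′) * marked S !) → ∀ a →
    sumL (λ d → 𝟙 (hasProfile (true ∷ᵥ S) R (a ∷ᵥ d))) (allVecs n (suc k)) * factorials R
      ≡ R a * (𝟙 (marked S ≡ᵇ total R ∸ 1) * marked S !)
  marked-head-colour {n} S R IH a with R a in Ra
  ... | zero = cong (_* factorials R)
                 (trans (sumL-cong (allVecs n (suc k)) (λ d → cong 𝟙 (profile-marked-head-absent S R a Ra d)))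
                        (sumL-zero (allVecs n (suc k))))
  ... | suc r = begin
    sumL (λ d → 𝟙 (hasProfile (true ∷ᵥ S) R (a ∷ᵥ d))) (allVecs n (suc k)) * factorials R
      ≡⟨ cong₂ _*_ (sumL-cong (allVecs n (suc k)) (λ d → cong 𝟙 (profile-marked-head R a Ra S d)))
                   (factorials-removeColour R a Ra) ⟩
    colourings S R′ * (suc r * factorials R′)
      ≡⟨ x∙yz≈y∙xz (colourings S R′) (suc r) (factorials R′) ⟩
    suc r * (colourings S R′ * factorials R′)
      ≡⟨ cong (suc r *_) (IH R′) ⟩
    suc r * (𝟙 (marked S ≡ᵇ total R′) * marked S !)
      ≡⟨ cong (λ m → suc r * (𝟙 (marked S ≡ᵇ m) * marked S !)) (cong (_∸ 1) (sym (total-removeColour R a Ra))) ⟩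
    suc r * (𝟙 (marked S ≡ᵇ total R ∸ 1) * marked S !) ∎
    where
    open ≡-Reasoning
    R′ : Colour → ℕ
    R′ = removeColour R a

  -- The multinomial count, by induction on the positions: an unmarked first position is
  -- irrelevant, and a marked one of colour a reduces the profile by one at a.
  multinomial : ∀ {n} (S : Vec Bool n) R → colourings S R * factorials R ≡ 𝟙 (marked S ≡ᵇ total R) * marked S !
  multinomial []ᵥ R = trans (cong (_* factorials R) (+-identityʳ (𝟙 (everyFin (suc k) (λ j → 0 ≡ᵇ R j)))))
                            (trans (empty-profile (suc k) R) (sym (*-identityʳ _)))
  multinomial (false ∷ᵥ S) R = trans (cong (_* factorials R) (colourings-unmarked-head S R)) (multinomial S R)
  multinomial {suc n} (true ∷ᵥ S) R = begin
    colourings (true ∷ᵥ S) R * factorials R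
      ≡⟨ cong (_* factorials R) (allVecs-split n (suc k) (𝟙 ∘ hasProfile (true ∷ᵥ S) R)) ⟩
    sumFin (suc k) headColour * factorials R
      ≡⟨ sym (sumFin-*ʳ (suc k) headColour (factorials R)) ⟩
    sumFin (suc k) (λ a → headColour a * factorials R)
      ≡⟨ sumFin-cong (suc k) (marked-head-colour S R (multinomial S)) ⟩
    sumFin (suc k) (λ a → R a * (𝟙 (marked S ≡ᵇ total R ∸ 1) * marked S !))
      ≡⟨ sumFin-*ʳ (suc k) R _ ⟩
    total R * (𝟙 (marked S ≡ᵇ total R ∸ 1) * marked S !)
      ≡⟨ weighted-indicator (total R) (marked S) (marked S !) ⟩
    𝟙 (suc (marked S) ≡ᵇ total R) * suc (marked S) ! ∎
    where
    open ≡-Reasoning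
    headColour : Colour → ℕ
    headColour a = sumL (λ d → 𝟙 (hasProfile (true ∷ᵥ S) R (a ∷ᵥ d))) (allVecs n (suc k))

-- A cycle is represented by its least element (the
-- points where isCycleMin σ holds), found as the least of the first n iterates; since every
-- iterate of x is among these, and x is an iterate of each of its iterates, this
-- representative is the same for all points of a cycle.

module Cycles {n : ℕ} (σ : Vec (Fin n) n) (σ-perm : isPerm σ ≡ true) where

  π : Fin n → Fin n
  π = lookup σ

  π-injective : ∀ {x y} → π x ≡ π y → x ≡ y
  π-injective {x} {y} πx≡πy = finEq-sound (injectivity (all-allFin-sound n (all-allFin-sound n σ-perm x) y))
    where
    injectivity : (if finEq (π x) (π y) then finEq x y else true) ≡ true → finEq x y ≡ true
    injectivity h rewrite πx≡πy | finEq-refl (π y) = h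

  iter-+ : ∀ a b x → iter σ (a + b) x ≡ iter σ a (iter σ b x)
  iter-+ zero    b x = refl
  iter-+ (suc a) b x = cong π (iter-+ a b x)

  iter-injective : ∀ a {x y} → iter σ a x ≡ iter σ a y → x ≡ y
  iter-injective zero    e = e
  iter-injective (suc a) e = iter-injective a (π-injective e)

  -- By the pigeonhole principle two of x, π x, …, πⁿ x coincide, so x lies on a cycle of
  -- length at most n.
  period : ∀ x → Σ ℕ λ q → suc q ≤ n × iter σ (suc q) x ≡ x
  period x with pigeonhole (n<1+n n) (λ i → iter σ (toℕ i) x)
  ... | i , j , i<j , πⁱx≡πʲx with m≤n⇒∃[o]m+o≡n i<j
  ... | q , 1+i+q≡j = q , 1+q≤n , sym (iter-injective (toℕ i) (trans πⁱx≡πʲx πʲx≡πⁱ⁺¹⁺ᑫx))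
    where
    1+q≤n : suc q ≤ n
    1+q≤n = ≤-trans (subst (suc q ≤_) 1+i+q≡j (s≤s (m≤n+m q (toℕ i)))) (≤-pred (toℕ<n j))
    πʲx≡πⁱ⁺¹⁺ᑫx : iter σ (toℕ j) x ≡ iter σ (toℕ i) (iter σ (suc q) x)
    πʲx≡πⁱ⁺¹⁺ᑫx = trans (cong (λ m → iter σ m x) (trans (sym 1+i+q≡j) (sym (+-suc (toℕ i) q))))
                        (iter-+ (toℕ i) (suc q) x)

  iter-period-multiple : ∀ x q → iter σ (suc q) x ≡ x → ∀ m → iter σ (m * suc q) x ≡ x
  iter-period-multiple x q πᵖx≡x zero    = refl
  iter-period-multiple x q πᵖx≡x (suc m) =
    trans (iter-+ (suc q) (m * suc q) x) (trans (cong (iter σ (suc q)) (iter-period-multiple x q πᵖx≡x m)) πᵖx≡x)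

  iter-reduce : ∀ a x → Σ ℕ λ b → b < n × iter σ a x ≡ iter σ b x
  iter-reduce a x with period x
  ... | q , 1+q≤n , πᵖx≡x = a % suc q , ≤-trans (m%n<n a (suc q)) 1+q≤n ,
    trans (cong (λ m → iter σ m x) (m≡m%n+[m/n]*n a (suc q)))
          (trans (iter-+ (a % suc q) _ x) (cong (iter σ (a % suc q)) (iter-period-multiple x q πᵖx≡x (a / suc q))))

  iter-orbit : ∀ x a b → Σ ℕ λ c → iter σ b x ≡ iter σ c (iter σ a x)
  iter-orbit x a b with period x
  ... | q , _ , πᵖx≡x = b + q * a , sym (trans (iter-+ b (q * a) (iter σ a x)) (cong (iter σ b) back))
    where
    back : iter σ (q * a) (iter σ a x) ≡ x
    back = trans (sym (iter-+ (q * a) a x))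
           (trans (cong (λ m → iter σ m x) (trans (+-comm (q * a) a) (*-comm (suc q) a)))
                  (iter-period-multiple x q πᵖx≡x a))

  cycleMin : Fin n → Bool
  cycleMin = isCycleMin σ

  -- isCycleMin only inspects the first n iterates, which suffices by iter-reduce.
  cycleMin-sound : ∀ y → cycleMin y ≡ true → ∀ a → toℕ y ≤ toℕ (iter σ a y)
  cycleMin-sound y h a with iter-reduce a y
  ... | b , b<n , πᵃy≡πᵇy =
    subst (λ z → toℕ y ≤ toℕ z) (sym πᵃy≡πᵇy)
          (≤ᵇ⇒≤ (toℕ y) (toℕ (iter σ b y)) (Equivalence.from T-≡ (all-applyUpTo-sound n id h b b<n)))

  cycleMin-complete : ∀ y → (∀ a → toℕ y ≤ toℕ (iter σ a y)) → cycleMin y ≡ true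
  cycleMin-complete y h = all-complete (upTo n) (λ a → Equivalence.to T-≡ (≤⇒≤ᵇ (h a)))

  cycleMin-unique : ∀ x a b → cycleMin (iter σ a x) ≡ true → cycleMin (iter σ b x) ≡ true → iter σ a x ≡ iter σ b x
  cycleMin-unique x a b min-a min-b with iter-orbit x a b | iter-orbit x b a
  ... | c , πᵇx≡πᶜπᵃx | c′ , πᵃx≡πᶜ′πᵇx = toℕ-injective (≤-antisym
    (subst (λ z → toℕ (iter σ a x) ≤ toℕ z) (sym πᵇx≡πᶜπᵃx) (cycleMin-sound _ min-a c))
    (subst (λ z → toℕ (iter σ b x) ≤ toℕ z) (sym πᵃx≡πᶜ′πᵇx) (cycleMin-sound _ min-b c′)))

  cycleRep : Fin n → Fin n
  cycleRep x = argmin toℕ x (applyUpTo (λ a → iter σ a x) n)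

  cycleRep-on-cycle : ∀ x → Σ ℕ λ a → cycleRep x ≡ iter σ a x
  cycleRep-on-cycle x =
    argmin-all toℕ {P = λ z → Σ ℕ λ a → z ≡ iter σ a x} (0 , refl) (applyUpTo⁺₂ _ n (λ a → a , refl))

  cycleRep-least : ∀ x a → toℕ (cycleRep x) ≤ toℕ (iter σ a x)
  cycleRep-least x a with iter-reduce a x
  ... | b , b<n , πᵃx≡πᵇx = subst (λ z → toℕ (cycleRep x) ≤ toℕ z) (sym πᵃx≡πᵇx)
    (applyUpTo⁻ (λ a → iter σ a x) n (f[argmin]≤f[xs] {f = toℕ} x (applyUpTo (λ a → iter σ a x) n)) b<n)

  cycleRep-isMin : ∀ x → cycleMin (cycleRep x) ≡ true
  cycleRep-isMin x with cycleRep-on-cycle x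
  ... | a , rep≡πᵃx = cycleMin-complete (cycleRep x) λ m →
    subst (λ z → toℕ (cycleRep x) ≤ toℕ (iter σ m z)) (sym rep≡πᵃx)
          (subst (λ z → toℕ (cycleRep x) ≤ toℕ z) (iter-+ m a x) (cycleRep-least x (m + a)))

  cycleRep-of-min : ∀ y → cycleMin y ≡ true → cycleRep y ≡ y
  cycleRep-of-min y min-y with cycleRep-on-cycle y
  ... | a , rep≡πᵃy = toℕ-injective (≤-antisym (cycleRep-least y 0)
                        (subst (λ z → toℕ y ≤ toℕ z) (sym rep≡πᵃy) (cycleMin-sound y min-y a)))

  -- x and π x lie on the same cycle, hence have the same representative.
  cycleRep-π : ∀ x → cycleRep (π x) ≡ cycleRep x
  cycleRep-π x with cycleRep-on-cycle (π x) | cycleRep-on-cycle x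
  ... | a , repπx≡πᵃπx | b , repx≡πᵇx =
    trans repπx≡πᵃ⁺¹x (trans (cycleMin-unique x (a + 1) b min-a+1 min-b) (sym repx≡πᵇx))
    where
    repπx≡πᵃ⁺¹x : cycleRep (π x) ≡ iter σ (a + 1) x
    repπx≡πᵃ⁺¹x = trans repπx≡πᵃπx (sym (iter-+ a 1 x))
    min-a+1 : cycleMin (iter σ (a + 1) x) ≡ true
    min-a+1 = subst (λ z → cycleMin z ≡ true) repπx≡πᵃ⁺¹x (cycleRep-isMin (π x))
    min-b : cycleMin (iter σ b x) ≡ true
    min-b = subst (λ z → cycleMin z ≡ true) repx≡πᵇx (cycleRep-isMin x)

  colour-cycleRep : ∀ {k} (c : Vec (Fin k) n) → isCycleColouring σ c ≡ true →
    ∀ x → lookup c (cycleRep x) ≡ lookup c x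
  colour-cycleRep c c-cyc x with cycleRep-on-cycle x
  ... | a , rep≡πᵃx = trans (cong (lookup c) rep≡πᵃx) (colour-iter a x)
    where
    colour-iter : ∀ a x → lookup c (iter σ a x) ≡ lookup c x
    colour-iter zero    x = refl
    colour-iter (suc a) x = trans (finEq-sound (all-allFin-sound n c-cyc (iter σ a x))) (colour-iter a x)

-- A colouring constant on cycles is determined by
-- the colours of the cycle representatives: restricting to the representatives (colour 0
-- elsewhere) and extending along cycles are inverse bijections between cycle colourings of
-- σ with cycle-colour profile R and colourings supported on the representatives with profile R.

module MixedColourings {n : ℕ} (σ : Vec (Fin n) n) (σ-perm : isPerm σ ≡ true) (k t : ℕ) where
  open Cycles σ σ-perm
  open Multinomial k

  minima : Vec Bool n
  minima = tabulateᵥ cycleMin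

  mixedProfile : Colour → ℕ
  mixedProfile fz     = t
  mixedProfile (fs _) = 1

  restrict : Vec Colour n → Vec Colour n
  restrict c = tabulateᵥ (λ x → if cycleMin x then lookup c x else fz)

  extend : Vec Colour n → Vec Colour n
  extend d = tabulateᵥ (λ x → lookup d (cycleRep x))

  cyclesOfColour-count : ∀ (c : Vec Colour n) j →
    cyclesOfColour σ c j ≡ countFin n (λ x → cycleMin x ∧ finEq (lookup c x) j)
  cyclesOfColour-count c j = length-filter-allFin n _

  isMixed-profile : ∀ c →
    isMixed t σ c ≡ isCycleColouring σ c ∧ everyFin (suc k) (λ j → cyclesOfColour σ c j ≡ᵇ mixedProfile j)
  isMixed-profile c = cong (λ b → isCycleColouring σ c ∧ ((cyclesOfColour σ c fz ≡ᵇ t) ∧ b)) (all-allFin k _)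

  classSize-restrict : ∀ c j → classSize minima (restrict c) j ≡ cyclesOfColour σ c j
  classSize-restrict c j = trans (countFin-cong n pointwise) (sym (cyclesOfColour-count c j))
    where
    pointwise : ∀ x → (lookup minima x ∧ finEq (lookup (restrict c) x) j) ≡ (cycleMin x ∧ finEq (lookup c x) j)
    pointwise x rewrite lookup∘tabulate cycleMin x | lookup∘tabulate (λ x → if cycleMin x then lookup c x else fz) x
      with cycleMin x
    ... | true  = refl
    ... | false = refl

  restrict-supported : ∀ c → supportedOn minima (restrict c) ≡ true
  restrict-supported c = everyFin-complete n pointwise
    where
    pointwise : ∀ x → (lookup minima x ∨ finEq (lookup (restrict c) x) fz) ≡ true
    pointwise x rewrite lookup∘tabulate cycleMin x | lookup∘tabulate (λ x → if cycleMin x then lookup c x else fz) x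
      with cycleMin x
    ... | true  = refl
    ... | false = refl

  extend-restrict : ∀ c → isCycleColouring σ c ≡ true → extend (restrict c) ≡ c
  extend-restrict c c-cyc = vec-ext pointwise
    where
    pointwise : ∀ x → lookup (extend (restrict c)) x ≡ lookup c x
    pointwise x rewrite lookup∘tabulate (λ x → lookup (restrict c) (cycleRep x)) x
                      | lookup∘tabulate (λ x → if cycleMin x then lookup c x else fz) (cycleRep x)
                      | cycleRep-isMin x = colour-cycleRep c c-cyc x

  extend-cycleColouring : ∀ d → isCycleColouring σ (extend d) ≡ true
  extend-cycleColouring d = all-complete (allFin n) pointwise
    where
    pointwise : ∀ x → finEq (lookup (extend d) (π x)) (lookup (extend d) x) ≡ true
    pointwise x rewrite lookup∘tabulate (λ x → lookup d (cycleRep x)) (π x)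
                      | lookup∘tabulate (λ x → lookup d (cycleRep x)) x
                      | cycleRep-π x = finEq-refl _

  cyclesOfColour-extend : ∀ d j → cyclesOfColour σ (extend d) j ≡ classSize minima d j
  cyclesOfColour-extend d j = trans (cyclesOfColour-count (extend d) j) (countFin-cong n pointwise)
    where
    pointwise : ∀ x → (cycleMin x ∧ finEq (lookup (extend d) x) j) ≡ (lookup minima x ∧ finEq (lookup d x) j)
    pointwise x rewrite lookup∘tabulate cycleMin x | lookup∘tabulate (λ x → lookup d (cycleRep x)) x
      with cycleMin x in min-x
    ... | true  rewrite cycleRep-of-min x min-x = refl
    ... | false = refl

  restrict-extend : ∀ d → supportedOn minima d ≡ true → restrict (extend d) ≡ d
  restrict-extend d d-supp = vec-ext λ x → trans (lookup∘tabulate _ x) (pointwise x (everyFin-sound n d-supp x))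
    where
    pointwise : ∀ x → (lookup minima x ∨ finEq (lookup d x) fz) ≡ true →
      (if cycleMin x then lookup (extend d) x else fz) ≡ lookup d x
    pointwise x h rewrite lookup∘tabulate cycleMin x with cycleMin x in min-x
    ... | true  = trans (lookup∘tabulate _ x) (cong (lookup d) (cycleRep-of-min x min-x))
    ... | false = sym (finEq-sound h)

  mixed-count : sumL (𝟙 ∘ isMixed t σ) (allVecs n (suc k)) ≡ colourings minima mixedProfile
  mixed-count = count-bijection
    where
    restrict-maps : ∀ c → isMixed t σ c ≡ true →
      hasProfile minima mixedProfile (restrict c) ≡ true × extend (restrict c) ≡ c
    restrict-maps c c-mixed with ∧-split {isCycleColouring σ c} (trans (sym (isMixed-profile c)) c-mixed)
    ... | c-cyc , c-prof =
      ∧-intro (restrict-supported c)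
              (trans (everyFin-cong (suc k) (λ j → cong (_≡ᵇ mixedProfile j) (classSize-restrict c j))) c-prof) ,
      extend-restrict c c-cyc
    extend-maps : ∀ d → hasProfile minima mixedProfile d ≡ true →
      isMixed t σ (extend d) ≡ true × restrict (extend d) ≡ d
    extend-maps d d-prof with ∧-split {supportedOn minima d} d-prof
    ... | d-supp , d-sizes =
      trans (isMixed-profile (extend d))
            (∧-intro (extend-cycleColouring d)
                     (trans (everyFin-cong (suc k) (λ j → cong (_≡ᵇ mixedProfile j) (cyclesOfColour-extend d j))) d-sizes)) ,
      restrict-extend d d-supp
    open DoubleCounting _≟ᵥ_ _≟ᵥ_ (allVecs n (suc k)) (allVecs n (suc k))
                        (allVecs-enumerates n (suc k)) (allVecs-enumerates n (suc k))
                        (isMixed t σ) (hasProfile minima mixedProfile) restrict extend restrict-maps extend-maps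

  minima-numCycles : marked minima ≡ numCycles σ
  minima-numCycles = trans (countFin-cong n (lookup∘tabulate cycleMin)) (sym (length-filter-allFin n cycleMin))

fallingFact-factorial : ∀ x m → m ≤ x → fallingFact x m * (x ∸ m) ! ≡ x !
fallingFact-factorial x zero    _      = +-identityʳ (x !)
fallingFact-factorial x (suc m) 1+m≤x = begin
  fallingFact x m * (x ∸ m) * (x ∸ suc m) !    ≡⟨ *-assoc (fallingFact x m) (x ∸ m) _ ⟩
  fallingFact x m * ((x ∸ m) * (x ∸ suc m) !)  ≡⟨ cong (fallingFact x m *_) (sym [x∸m]!-unfold) ⟩
  fallingFact x m * (x ∸ m) !                  ≡⟨ fallingFact-factorial x m (≤-trans (n≤1+n m) 1+m≤x) ⟩
  x ! ∎
  where
  open ≡-Reasoning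
  [x∸m]!-unfold : (x ∸ m) ! ≡ (x ∸ m) * (x ∸ suc m) !
  [x∸m]!-unfold rewrite +-∸-assoc 1 1+m≤x = refl

cancel-factorial : ∀ N f m x t → N * t ! ≡ 𝟙 (m ≡ᵇ x) * m ! → f * t ! ≡ x ! → N ≡ 𝟙 (m ≡ᵇ x) * f
cancel-factorial N f m x t N·t!≡ f·t!≡x! = *-cancelʳ-≡ N (𝟙 (m ≡ᵇ x) * f) (t !) {{t !≢0}} (trans N·t!≡ same-side)
  where
  same-side : 𝟙 (m ≡ᵇ x) * m ! ≡ 𝟙 (m ≡ᵇ x) * f * t !
  same-side with m ≡ᵇ x in m≟x
  ... | false = refl
  ... | true rewrite ≡ᵇ⇒≡ m x (Equivalence.from T-≡ m≟x) =
    trans (*-identityˡ (x !)) (sym (trans (cong (_* t !) (*-identityˡ f)) f·t!≡x!))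

-- A permutation of [n] admits (t+k)ₖ mixed colourings with 1+k colours if it has t + k cycles,
-- and none otherwise: the t special cycles are unordered, the k others are ordered.
mixed-colourings-per-permutation : ∀ {n} (σ : Vec (Fin n) n) → isPerm σ ≡ true → ∀ k t →
  sumL (𝟙 ∘ isMixed t σ) (allVecs n (suc k)) ≡ 𝟙 (numCycles σ ≡ᵇ t + k) * fallingFact (t + k) k
mixed-colourings-per-permutation σ σ-perm k t =
  trans mixed-count (cancel-factorial _ _ (numCycles σ) (t + k) t count·t! falling·t!)
  where
  open MixedColourings σ σ-perm k t
  open Multinomial k
  factorials-mixed : factorials mixedProfile ≡ t !
  factorials-mixed = trans (cong (t ! *_) (prodFin-one k)) (*-identityʳ (t !))
  total-mixed : total mixedProfile ≡ t + k
  total-mixed = cong (t +_) (sumFin-one k)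
  count·t! : colourings minima mixedProfile * t ! ≡ 𝟙 (numCycles σ ≡ᵇ t + k) * numCycles σ !
  count·t! = begin
    colourings minima mixedProfile * t !
      ≡⟨ cong (colourings minima mixedProfile *_) (sym factorials-mixed) ⟩
    colourings minima mixedProfile * factorials mixedProfile
      ≡⟨ multinomial minima mixedProfile ⟩
    𝟙 (marked minima ≡ᵇ total mixedProfile) * marked minima !
      ≡⟨ cong₂ (λ m s → 𝟙 (m ≡ᵇ s) * m !) minima-numCycles total-mixed ⟩
    𝟙 (numCycles σ ≡ᵇ t + k) * numCycles σ ! ∎
    where open ≡-Reasoning
  falling·t! : fallingFact (t + k) k * t ! ≡ (t + k) !
  falling·t! = subst (λ s → fallingFact (t + k) k * s ! ≡ (t + k) !) (m+n∸n≡m t k)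
                     (fallingFact-factorial (t + k) k (m≤n+m k t))

-- Theorem 6: [n | k/t] = (t+k−1)_{k−1} [n | t+k−1].  Summing the per-permutation count over all
-- permutations of [n] picks out those with t + k − 1 cycles.
mainTheorem6 : (n k t : ℕ) → 1 ≤ n → 1 ≤ k → 1 ≤ t → k ≤ n → t ≤ n →
    mixedStirling n k t ≡ fallingFact (t + k ∸ 1) (k ∸ 1) * stirling1 n (t + k ∸ 1)
mainTheorem6 n zero    t _ () _ _ _
mainTheorem6 n (suc k) t _ _  _ _ _ = begin
  mixedStirling n (suc k) t
    ≡⟨ length-filterᵇ _ (cartesianProduct (perms n) (allVecs n (suc k))) ⟩
  sumL (λ p → 𝟙 (isMixed t (proj₁ p) (proj₂ p))) (cartesianProduct (perms n) (allVecs n (suc k)))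
    ≡⟨ sumL-cartesianProduct _ (perms n) (allVecs n (suc k)) ⟩
  sumL (λ σ → sumL (𝟙 ∘ isMixed t σ) (allVecs n (suc k))) (perms n)
    ≡⟨ sumL-filter-cong isPerm (allVecs n n) (λ σ σ-perm → mixed-colourings-per-permutation σ σ-perm k t) ⟩
  sumL (λ σ → 𝟙 (numCycles σ ≡ᵇ t + k) * falling) (perms n)
    ≡⟨ sumL-cong (perms n) (λ σ → *-comm (𝟙 (numCycles σ ≡ᵇ t + k)) falling) ⟩
  sumL (λ σ → falling * 𝟙 (numCycles σ ≡ᵇ t + k)) (perms n)
    ≡⟨ sumL-*ˡ falling _ (perms n) ⟩
  falling * sumL (λ σ → 𝟙 (numCycles σ ≡ᵇ t + k)) (perms n)
    ≡⟨ cong (falling *_) (sym (length-filterᵇ _ (perms n))) ⟩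
  falling * stirling1 n (t + k)
    ≡⟨ cong (λ x → fallingFact x k * stirling1 n x) (sym (cong (_∸ 1) (+-suc t k))) ⟩
  fallingFact (t + suc k ∸ 1) k * stirling1 n (t + suc k ∸ 1) ∎
  where
  open ≡-Reasoning
  falling : ℕ
  falling = fallingFact (t + k) k
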